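{- Let $n\ge1$ and let $M=(m_{S,T})$ be the $(2^n-1)\times(2^n-1)$ matrix indexed by the nonempty subsets $S,T\subseteq\{1,\dots,n\}$ with $m_{S,T}=1$ if $S\cap T\ne\emptyset$ and $m_{S,T}=0$ otherwise. Let $r=(r_S)_{\emptyset\ne S\subseteq\{1,\dots,n\}}$ be a real vector, and set $r_\emptyset=0$. Then the unique solution $x$ of $Mx=r$ satisfies $x_T\ge 0$ for all nonempty $T\subseteq\{1,\dots,n\}$ if and only if for every proper subset $S\subsetneq\{1,\dots,n\}$ (including $S=\emptyset$) $$\sum_{S\subseteq T\subseteq\{1,\dots,n\}}(-1)^{|S|+|T|}\,r_T\le 0 .$$
   Context: $M$ is invertible, so the solution of $Mx=r$ is unique. -}

module Defs where

open import Level using (Level; _⊔_) renaming (suc to lsuc)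
open import Data.Nat using (ℕ; zero; suc) renaming (_+_ to _ℕ+_)
open import Data.Bool using (if_then_else_)
open import Data.Product using (∃)
open import Data.List using (List; []; _∷_; _++_; map; foldr)
open import Data.Vec using ([]; _∷_)
open import Data.Fin.Subset using (Subset; inside; outside; _∩_; _⊆_; ∣_∣)
open import Data.Fin.Subset.Properties using (nonempty?; _⊆?_)
open import Relation.Nullary using (¬_; does)
open import Relation.Binary.Structures using (IsTotalOrder)
open import Algebra.Bundles using (CommutativeRing)

-- An ordered field (the real numbers are the intended model).
record OrderedField (c ℓ₁ ℓ₂ : Level) : Set (lsuc (c ⊔ ℓ₁ ⊔ ℓ₂)) where
  field
    commutativeRing : CommutativeRing c ℓ₁
  open CommutativeRing commutativeRing public
  field
    _≤_          : Carrier → Carrier → Set ℓ₂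
    isTotalOrder : IsTotalOrder _≈_ _≤_
    0≉1          : ¬ (0# ≈ 1#)
    inverse      : ∀ x → ¬ (x ≈ 0#) → ∃ λ y → x * y ≈ 1#
    +-mono-≤     : ∀ {x y} z → x ≤ y → x + z ≤ y + z
    *-nonneg     : ∀ {x y} → 0# ≤ x → 0# ≤ y → 0# ≤ x * y
  infix 4 _≤_

allSubsets : (n : ℕ) → List (Subset n)
allSubsets zero    = [] ∷ []
allSubsets (suc n) = map (outside ∷_) (allSubsets n) ++ map (inside ∷_) (allSubsets n)

module _ {c ℓ₁ ℓ₂} (F : OrderedField c ℓ₁ ℓ₂) where
  open OrderedField F

  sumSubsets : (n : ℕ) → (Subset n → Carrier) → Carrier
  sumSubsets n f = foldr (λ T acc → f T + acc) 0# (allSubsets n)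

  signPow : ℕ → Carrier
  signPow zero    = 1#
  signPow (suc k) = - signPow k

  intersectionMatrix : {n : ℕ} → Subset n → Subset n → Carrier
  intersectionMatrix S T = if does (nonempty? (S ∩ T)) then 1# else 0#

  -- (M x)_S = Σ_T m_{S,T} x_T   (x_∅ enters with coefficient 0)
  applyM : {n : ℕ} → (Subset n → Carrier) → Subset n → Carrier
  applyM {n} x S = sumSubsets n (λ T → intersectionMatrix S T * x T)

  upperAltSum : {n : ℕ} → (Subset n → Carrier) → Subset n → Carrier
  upperAltSum {n} r S =
    sumSubsets n (λ T → if does (S ⊆? T) then signPow (∣ S ∣ ℕ+ ∣ T ∣) * r T else 0#)

{-# OPTIONS --safe #-}
module Submission where

-- Both M and the alternating sums factor over the coordinates.  The indicator of T ∩ U = ∅ is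
-- the n-th tensor power of a 2×2 kernel, so M = J − Z with J the all-ones matrix and Z that
-- tensor power; and upperAltSum applies the tensor power of the 2×2 Möbius kernel μ of the
-- Boolean lattice.  Products of tensor powers are computed coordinatewise: μ·J vanishes on every
-- row S ≠ ⊤, and μ·Z is the permutation matrix of S ↦ ∁ S.  Hence upperAltSum r S = − x (∁ S)
-- for every proper S (r ∅ = 0 makes r = M x on the empty row as well), and the two sides of
-- the equivalence are the same inequalities.

open import Defs
open import Data.Nat using (ℕ; _≥_; suc) renaming (_+_ to _ℕ+_)
open import Data.Nat.Properties using (+-suc)
open import Data.Bool using (Bool; true; false; not; if_then_else_)
open import Data.Bool.Properties using (not-involutive)
open import Data.Product using (_,_)
open import Data.List using (List; []; _∷_; _++_; map; foldr)
open import Data.List.Properties using (foldr-map)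
open import Data.Vec using ([]; _∷_; here; there)
open import Data.Vec.Properties using (∷-injectiveʳ; map-∘; map-cong; map-id)
open import Data.Fin using (Fin; zero; suc)
open import Data.Fin.Subset
  using (Subset; ⊥; ⊤; Nonempty; _⊂_; inside; outside; _∩_; _∈_; _∉_; ∁; ∣_∣)
open import Data.Fin.Subset.Properties
  using (nonempty?; _⊆?_; Empty-unique; ∈⊤; x∈p⇒x∉∁p; x∉p⇒x∈∁p; ∩-zeroˡ)
open import Function using (_∘_)
open import Function.Bundles using (_⇔_; mk⇔; Equivalence)
open import Relation.Nullary using (does; yes; no; contradiction)
open import Relation.Binary.PropositionalEquality as ≡ using (_≡_)
open import Relation.Binary.Structures using (IsTotalOrder)
open import Algebra.Bundles using (CommutativeRing)

∁-involutive : ∀ {n} (S : Subset n) → ∁ (∁ S) ≡ S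
∁-involutive S =
  ≡.trans (≡.sym (map-∘ not not S)) (≡.trans (map-cong not-involutive S) (map-id S))

module SubsetMatrices {c ℓ} (R : CommutativeRing c ℓ) where

  open CommutativeRing R
  open import Algebra.Properties.Ring ring using (-1*x≈-x; -0#≈0#; -‿distribˡ-*; x[y-z]≈xy-xz)
  open import Algebra.Properties.CommutativeSemigroup +-commutativeSemigroup
    using () renaming (interchange to +-interchange)
  open import Algebra.Properties.CommutativeSemigroup *-commutativeSemigroup
    using (x∙yz≈y∙xz)
  open import Relation.Binary.Reasoning.Setoid setoid

  sumOver : {A : Set} → List A → (A → Carrier) → Carrier
  sumOver l f = foldr (λ a acc → f a + acc) 0# l

  module _ {A : Set} where

    sumOver-cong : ∀ (l : List A) {f g : A → Carrier} →
      (∀ a → f a ≈ g a) → sumOver l f ≈ sumOver l g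
    sumOver-cong []      f≈g = refl
    sumOver-cong (a ∷ l) f≈g = +-cong (f≈g a) (sumOver-cong l f≈g)

    sumOver-++ : ∀ (l₁ l₂ : List A) f → sumOver (l₁ ++ l₂) f ≈ sumOver l₁ f + sumOver l₂ f
    sumOver-++ []       l₂ f = sym (+-identityˡ _)
    sumOver-++ (a ∷ l₁) l₂ f = trans (+-congˡ (sumOver-++ l₁ l₂ f)) (sym (+-assoc _ _ _))

    sumOver-0 : ∀ (l : List A) → sumOver l (λ _ → 0#) ≈ 0#
    sumOver-0 []      = refl
    sumOver-0 (a ∷ l) = trans (+-identityˡ _) (sumOver-0 l)

    sumOver-+ : ∀ (l : List A) f g → sumOver l (λ a → f a + g a) ≈ sumOver l f + sumOver l g
    sumOver-+ []      f g = sym (+-identityˡ 0#)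
    sumOver-+ (a ∷ l) f g = trans (+-congˡ (sumOver-+ l f g)) (+-interchange _ _ _ _)

    sumOver-*ˡ : ∀ (l : List A) k f → sumOver l (λ a → k * f a) ≈ k * sumOver l f
    sumOver-*ˡ []      k f = sym (zeroʳ k)
    sumOver-*ˡ (a ∷ l) k f = trans (+-congˡ (sumOver-*ˡ l k f)) (sym (distribˡ k _ _))

    sumOver-*ʳ : ∀ (l : List A) k f → sumOver l (λ a → f a * k) ≈ sumOver l f * k
    sumOver-*ʳ l k f =
      trans (sumOver-cong l (λ a → *-comm (f a) k)) (trans (sumOver-*ˡ l k f) (*-comm k _))

    sumOver-neg : ∀ (l : List A) f → sumOver l (λ a → - f a) ≈ - sumOver l f
    sumOver-neg l f = begin
      sumOver l (λ a → - f a)      ≈⟨ sumOver-cong l (λ a → sym (-1*x≈-x (f a))) ⟩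
      sumOver l (λ a → - 1# * f a) ≈⟨ sumOver-*ˡ l (- 1#) f ⟩
      - 1# * sumOver l f           ≈⟨ -1*x≈-x _ ⟩
      - sumOver l f                ∎

  sumOver-comm : ∀ {A B : Set} (l₁ : List A) (l₂ : List B) (f : A → B → Carrier) →
    sumOver l₁ (λ a → sumOver l₂ (f a)) ≈ sumOver l₂ (λ b → sumOver l₁ (λ a → f a b))
  sumOver-comm []       l₂ f = sym (sumOver-0 l₂)
  sumOver-comm (a ∷ l₁) l₂ f =
    trans (+-congˡ (sumOver-comm l₁ l₂ f)) (sym (sumOver-+ l₂ (f a) _))

  -- Agrees definitionally with sumSubsets: applyM F x is literally apply (intersectionMatrix F) x.
  ∑ : (n : ℕ) → (Subset n → Carrier) → Carrier
  ∑ n = sumOver (allSubsets n)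

  ∑-suc : ∀ n (f : Subset (suc n) → Carrier) →
    ∑ (suc n) f ≈ ∑ n (f ∘ (outside ∷_)) + ∑ n (f ∘ (inside ∷_))
  ∑-suc n f = trans (sumOver-++ (map (outside ∷_) (allSubsets n)) _ f)
    (+-cong (reflexive (foldr-map _ _ 0# (allSubsets n)))
            (reflexive (foldr-map _ _ 0# (allSubsets n))))

  Matrix : ℕ → Set c
  Matrix n = Subset n → Subset n → Carrier

  apply : ∀ {n} → Matrix n → (Subset n → Carrier) → Subset n → Carrier
  apply {n} A v S = ∑ n (λ T → A S T * v T)

  infixl 7 _·_
  _·_ : ∀ {n} → Matrix n → Matrix n → Matrix n
  (A · B) S U = apply A (λ T → B T U) S

  apply-cong : ∀ {n} (A B : Matrix n) {v w : Subset n → Carrier} S →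
    (∀ T → A S T ≈ B S T) → (∀ T → v T ≈ w T) → apply A v S ≈ apply B w S
  apply-cong {n} A B S A≈B v≈w = sumOver-cong (allSubsets n) (λ T → *-cong (A≈B T) (v≈w T))

  apply-*ˡ : ∀ {n} (A : Matrix n) k v S → apply A (λ T → k * v T) S ≈ k * apply A v S
  apply-*ˡ {n} A k v S = trans (sumOver-cong (allSubsets n) (λ T → x∙yz≈y∙xz (A S T) k (v T)))
                               (sumOver-*ˡ (allSubsets n) k _)

  apply-· : ∀ {n} (A B : Matrix n) v S → apply A (apply B v) S ≈ apply (A · B) v S
  apply-· {n} A B v S = begin
    ∑ n (λ T → A S T * ∑ n (λ U → B T U * v U))
      ≈⟨ sumOver-cong (allSubsets n) (λ T → sym (sumOver-*ˡ (allSubsets n) (A S T) _)) ⟩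
    ∑ n (λ T → ∑ n (λ U → A S T * (B T U * v U)))
      ≈⟨ sumOver-comm (allSubsets n) (allSubsets n) _ ⟩
    ∑ n (λ U → ∑ n (λ T → A S T * (B T U * v U)))
      ≈⟨ sumOver-cong (allSubsets n) (λ U →
           sumOver-cong (allSubsets n) (λ T → sym (*-assoc _ _ _))) ⟩
    ∑ n (λ U → ∑ n (λ T → A S T * B T U * v U))
      ≈⟨ sumOver-cong (allSubsets n) (λ U → sumOver-*ʳ (allSubsets n) (v U) _) ⟩
    ∑ n (λ U → (A · B) S U * v U) ∎

  apply-neg : ∀ {n} (A : Matrix n) v S → apply (λ S U → - A S U) v S ≈ - apply A v S
  apply-neg {n} A v S = trans (sumOver-cong (allSubsets n) (λ U → sym (-‿distribˡ-* _ _)))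
                              (sumOver-neg (allSubsets n) _)

  Kernel : Set c
  Kernel = Bool → Bool → Carrier

  tensor : Kernel → ∀ {n} → Matrix n
  tensor k []      []      = 1#
  tensor k (s ∷ S) (t ∷ T) = k s t * tensor k S T

  infixl 7 _∘ₖ_
  _∘ₖ_ : Kernel → Kernel → Kernel
  (k ∘ₖ l) s u = k s outside * l outside u + k s inside * l inside u

  tensor-cong : ∀ {k l : Kernel} → (∀ s t → k s t ≈ l s t) →
    ∀ {n} (S T : Subset n) → tensor k S T ≈ tensor l S T
  tensor-cong k≈l []      []      = refl
  tensor-cong k≈l (s ∷ S) (t ∷ T) = *-cong (k≈l s t) (tensor-cong k≈l S T)

  tensor-vanishes : ∀ k {n} {i : Fin n} {S : Subset n} →
    (∀ u → k outside u ≈ 0#) → i ∉ S → ∀ U → tensor k S U ≈ 0#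
  tensor-vanishes k {i = zero}  {inside ∷ S}  _    i∉S _       = contradiction here i∉S
  tensor-vanishes k {i = zero}  {outside ∷ S} k₀≈0 _   (u ∷ U) = trans (*-congʳ (k₀≈0 u)) (zeroˡ _)
  tensor-vanishes k {i = suc i} {s ∷ S}       k₀≈0 i∉S (u ∷ U) =
    trans (*-congˡ (tensor-vanishes k k₀≈0 (i∉S ∘ there) U)) (zeroʳ _)

  apply-tensor-∷ : ∀ k {n} (v : Subset (suc n) → Carrier) s S →
    apply (tensor k) v (s ∷ S) ≈
      k s outside * apply (tensor k) (v ∘ (outside ∷_)) S
        + k s inside * apply (tensor k) (v ∘ (inside ∷_)) S
  apply-tensor-∷ k {n} v s S = trans (∑-suc n _) (+-cong (factor outside) (factor inside))
    where
    factor : ∀ t → ∑ n (λ T → k s t * tensor k S T * v (t ∷ T))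
                     ≈ k s t * apply (tensor k) (v ∘ (t ∷_)) S
    factor t = trans (sumOver-cong (allSubsets n) (λ T → *-assoc _ _ _))
                     (sumOver-*ˡ (allSubsets n) (k s t) _)

  tensor-· : ∀ k l {n} (S U : Subset n) → (tensor k · tensor l) S U ≈ tensor (k ∘ₖ l) S U
  tensor-· k l []      []      = trans (+-identityʳ _) (*-identityˡ _)
  tensor-· k l (s ∷ S) (u ∷ U) = begin
    (tensor k · tensor l) (s ∷ S) (u ∷ U)
      ≈⟨ apply-tensor-∷ k _ s S ⟩
    k s outside * apply (tensor k) (λ T → l outside u * tensor l T U) S
      + k s inside * apply (tensor k) (λ T → l inside u * tensor l T U) S
      ≈⟨ +-cong (*-congˡ (apply-*ˡ (tensor k) _ _ S)) (*-congˡ (apply-*ˡ (tensor k) _ _ S)) ⟩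
    k s outside * (l outside u * P) + k s inside * (l inside u * P)
      ≈⟨ +-cong (sym (*-assoc _ _ _)) (sym (*-assoc _ _ _)) ⟩
    k s outside * l outside u * P + k s inside * l inside u * P
      ≈⟨ sym (distribʳ P _ _) ⟩
    (k ∘ₖ l) s u * P
      ≈⟨ *-congˡ (tensor-· k l S U) ⟩
    (k ∘ₖ l) s u * tensor (k ∘ₖ l) S U ∎
    where
    P : Carrier
    P = (tensor k · tensor l) S U

  complement : Kernel
  complement outside outside = 0#
  complement outside inside  = 1#
  complement inside  outside = 1#
  complement inside  inside  = 0#

  apply-tensor-complement : ∀ {n} (v : Subset n → Carrier) S →
    apply (tensor complement) v S ≈ v (∁ S)
  apply-tensor-complement v []            = trans (+-identityʳ _) (*-identityˡ _)
  apply-tensor-complement v (outside ∷ S) = begin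
    apply (tensor complement) v (outside ∷ S)
      ≈⟨ apply-tensor-∷ complement v outside S ⟩
    0# * _ + 1# * apply (tensor complement) (v ∘ (inside ∷_)) S
      ≈⟨ +-cong (zeroˡ _) (*-identityˡ _) ⟩
    0# + apply (tensor complement) (v ∘ (inside ∷_)) S
      ≈⟨ +-identityˡ _ ⟩
    apply (tensor complement) (v ∘ (inside ∷_)) S
      ≈⟨ apply-tensor-complement (v ∘ (inside ∷_)) S ⟩
    v (inside ∷ ∁ S) ∎
  apply-tensor-complement v (inside ∷ S) = begin
    apply (tensor complement) v (inside ∷ S)
      ≈⟨ apply-tensor-∷ complement v inside S ⟩
    1# * apply (tensor complement) (v ∘ (outside ∷_)) S + 0# * _
      ≈⟨ +-cong (*-identityˡ _) (zeroˡ _) ⟩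
    apply (tensor complement) (v ∘ (outside ∷_)) S + 0#
      ≈⟨ +-identityʳ _ ⟩
    apply (tensor complement) (v ∘ (outside ∷_)) S
      ≈⟨ apply-tensor-complement (v ∘ (outside ∷_)) S ⟩
    v (outside ∷ ∁ S) ∎

  möbius : Kernel
  möbius outside outside = 1#
  möbius outside inside  = - 1#
  möbius inside  outside = 0#
  möbius inside  inside  = 1#

  allOnes : Kernel
  allOnes _ _ = 1#

  disjoint : Kernel
  disjoint outside outside = 1#
  disjoint outside inside  = 1#
  disjoint inside  outside = 1#
  disjoint inside  inside  = 0#

  intersecting : ∀ {n} → Matrix n
  intersecting T U = tensor allOnes T U - tensor disjoint T U

  tensor-allOnes : ∀ {n} (S T : Subset n) → tensor allOnes S T ≈ 1#
  tensor-allOnes []      []      = refl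
  tensor-allOnes (s ∷ S) (t ∷ T) = trans (*-identityˡ _) (tensor-allOnes S T)

  tensor-disjoint-meet : ∀ {n} (T U : Subset n) {i} → i ∈ T ∩ U → tensor disjoint T U ≈ 0#
  tensor-disjoint-meet (inside ∷ T) (inside ∷ U) here      = zeroˡ _
  tensor-disjoint-meet (t ∷ T)      (u ∷ U)      (there p) =
    trans (*-congˡ (tensor-disjoint-meet T U p)) (zeroʳ _)

  tensor-disjoint-empty : ∀ {n} (T U : Subset n) → T ∩ U ≡ ⊥ → tensor disjoint T U ≈ 1#
  tensor-disjoint-empty []            []            _ = refl
  tensor-disjoint-empty (outside ∷ T) (outside ∷ U) T∩U≡⊥ =
    trans (*-identityˡ _) (tensor-disjoint-empty T U (∷-injectiveʳ T∩U≡⊥))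
  tensor-disjoint-empty (outside ∷ T) (inside ∷ U)  T∩U≡⊥ =
    trans (*-identityˡ _) (tensor-disjoint-empty T U (∷-injectiveʳ T∩U≡⊥))
  tensor-disjoint-empty (inside ∷ T)  (outside ∷ U) T∩U≡⊥ =
    trans (*-identityˡ _) (tensor-disjoint-empty T U (∷-injectiveʳ T∩U≡⊥))
  tensor-disjoint-empty (inside ∷ T)  (inside ∷ U)  ()

  intersecting-meet : ∀ {n} (T U : Subset n) {i} → i ∈ T ∩ U → intersecting T U ≈ 1#
  intersecting-meet T U i∈T∩U = begin
    tensor allOnes T U - tensor disjoint T U
      ≈⟨ +-cong (tensor-allOnes T U) (-‿cong (tensor-disjoint-meet T U i∈T∩U)) ⟩
    1# - 0#  ≈⟨ +-congˡ -0#≈0# ⟩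
    1# + 0#  ≈⟨ +-identityʳ 1# ⟩
    1#       ∎

  intersecting-empty : ∀ {n} (T U : Subset n) → T ∩ U ≡ ⊥ → intersecting T U ≈ 0#
  intersecting-empty T U T∩U≡⊥ = begin
    tensor allOnes T U - tensor disjoint T U
      ≈⟨ +-cong (tensor-allOnes T U) (-‿cong (tensor-disjoint-empty T U T∩U≡⊥)) ⟩
    1# - 1#  ≈⟨ -‿inverseʳ 1# ⟩
    0#       ∎

  möbius∘allOnes-outside : ∀ u → (möbius ∘ₖ allOnes) outside u ≈ 0#
  möbius∘allOnes-outside u = trans (+-cong (*-identityˡ 1#) (*-identityʳ (- 1#))) (-‿inverseʳ 1#)

  möbius∘disjoint≈complement : ∀ s u → (möbius ∘ₖ disjoint) s u ≈ complement s u
  möbius∘disjoint≈complement outside outside =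
    trans (+-cong (*-identityˡ 1#) (*-identityʳ (- 1#))) (-‿inverseʳ 1#)
  möbius∘disjoint≈complement outside inside  =
    trans (+-cong (*-identityˡ 1#) (zeroʳ (- 1#))) (+-identityʳ 1#)
  möbius∘disjoint≈complement inside  outside =
    trans (+-cong (zeroˡ 1#) (*-identityˡ 1#)) (+-identityˡ 1#)
  möbius∘disjoint≈complement inside  inside  =
    trans (+-cong (zeroˡ 1#) (zeroʳ 1#)) (+-identityˡ 0#)

  tensor-möbius·intersecting : ∀ {n} {i : Fin n} {S : Subset n} → i ∉ S → ∀ U →
    (tensor möbius · intersecting) S U ≈ - tensor complement S U
  tensor-möbius·intersecting {n} {S = S} i∉S U = begin
    ∑ n (λ T → μ S T * (tensor allOnes T U - tensor disjoint T U))
      ≈⟨ sumOver-cong (allSubsets n) (λ T → x[y-z]≈xy-xz _ _ _) ⟩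
    ∑ n (λ T → μ S T * tensor allOnes T U - μ S T * tensor disjoint T U)
      ≈⟨ sumOver-+ (allSubsets n) _ _ ⟩
    (μ · tensor allOnes) S U + ∑ n (λ T → - (μ S T * tensor disjoint T U))
      ≈⟨ +-congˡ (sumOver-neg (allSubsets n) _) ⟩
    (μ · tensor allOnes) S U - (μ · tensor disjoint) S U
      ≈⟨ +-cong (tensor-· möbius allOnes S U) (-‿cong (tensor-· möbius disjoint S U)) ⟩
    tensor (möbius ∘ₖ allOnes) S U - tensor (möbius ∘ₖ disjoint) S U
      ≈⟨ +-cong (tensor-vanishes _ möbius∘allOnes-outside i∉S U)
                (-‿cong (tensor-cong möbius∘disjoint≈complement S U)) ⟩
    0# - tensor complement S U
      ≈⟨ +-identityˡ _ ⟩
    - tensor complement S U ∎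
    where
    μ : Matrix n
    μ = tensor möbius

  apply-möbius-intersecting : ∀ {n} (v : Subset n → Carrier) {i S} → i ∉ S →
    apply (tensor möbius) (apply intersecting v) S ≈ - v (∁ S)
  apply-möbius-intersecting v {S = S} i∉S = begin
    apply (tensor möbius) (apply intersecting v) S
      ≈⟨ apply-· (tensor möbius) intersecting v S ⟩
    apply (tensor möbius · intersecting) v S
      ≈⟨ apply-cong (tensor möbius · intersecting) (λ S U → - tensor complement S U) S
                    (tensor-möbius·intersecting i∉S) (λ _ → refl) ⟩
    apply (λ S U → - tensor complement S U) v S
      ≈⟨ apply-neg (tensor complement) v S ⟩
    - apply (tensor complement) v S
      ≈⟨ -‿cong (apply-tensor-complement v S) ⟩
    - v (∁ S) ∎

module _ {c ℓ₁ ℓ₂} (F : OrderedField c ℓ₁ ℓ₂) where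

  open OrderedField F
  open SubsetMatrices commutativeRing
  open import Algebra.Properties.Ring ring using (-1*x≈-x; -‿involutive)
  open import Relation.Binary.Reasoning.Setoid setoid
  open IsTotalOrder isTotalOrder using (≤-respˡ-≈; ≤-respʳ-≈)

  tensor-möbius : ∀ {n} (S T : Subset n) →
    tensor möbius S T ≈ (if does (S ⊆? T) then signPow F (∣ S ∣ ℕ+ ∣ T ∣) else 0#)
  tensor-möbius []            []            = refl
  tensor-möbius (outside ∷ S) (outside ∷ T) = trans (*-identityˡ _) (tensor-möbius S T)
  tensor-möbius (outside ∷ S) (inside ∷ T) with does (S ⊆? T) | tensor-möbius S T
  ... | true  | ih = trans (-1*x≈-x _) (trans (-‿cong ih)
                       (reflexive (≡.cong (signPow F) (≡.sym (+-suc ∣ S ∣ ∣ T ∣)))))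
  ... | false | ih = trans (*-congˡ ih) (zeroʳ _)
  tensor-möbius (inside ∷ S)  (outside ∷ T) = zeroˡ _
  tensor-möbius (inside ∷ S)  (inside ∷ T) with does (S ⊆? T) | tensor-möbius S T
  ... | true  | ih = trans (*-identityˡ _) (trans ih (sym (trans
                       (-‿cong (reflexive (≡.cong (signPow F) (+-suc ∣ S ∣ ∣ T ∣))))
                       (-‿involutive _))))
  ... | false | ih = trans (*-identityˡ _) ih

  if-*ʳ : ∀ b {x} y → (if b then x * y else 0#) ≈ (if b then x else 0#) * y
  if-*ʳ true  y = refl
  if-*ʳ false y = sym (zeroˡ y)

  upperAltSum≈apply-möbius : ∀ {n} (r : Subset n → Carrier) S →
    upperAltSum F r S ≈ apply (tensor möbius) r S
  upperAltSum≈apply-möbius {n} r S = sumOver-cong (allSubsets n)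
    (λ T → trans (if-*ʳ (does (S ⊆? T)) (r T)) (*-congʳ (sym (tensor-möbius S T))))

  intersectionMatrix≈intersecting : ∀ {n} (T U : Subset n) →
    intersectionMatrix F T U ≈ intersecting T U
  intersectionMatrix≈intersecting T U with nonempty? (T ∩ U)
  ... | yes (_ , i∈T∩U) = sym (intersecting-meet T U i∈T∩U)
  ... | no  T∩U≢∅       = sym (intersecting-empty T U (Empty-unique T∩U≢∅))

  applyM-⊥ : ∀ {n} (x : Subset n → Carrier) → applyM F x ⊥ ≈ 0#
  applyM-⊥ {n} x = trans (sumOver-cong (allSubsets n) vanishes) (sumOver-0 (allSubsets n))
    where
    vanishes : ∀ U → intersectionMatrix F ⊥ U * x U ≈ 0#
    vanishes U = trans (*-congʳ (trans (intersectionMatrix≈intersecting ⊥ U)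
                                       (intersecting-empty ⊥ U (∩-zeroˡ U))))
                       (zeroˡ _)

  upperAltSum≈-x∁ : ∀ {n} (r x : Subset n → Carrier) → (∀ T → r T ≈ applyM F x T) →
    ∀ {i S} → i ∉ S → upperAltSum F r S ≈ - x (∁ S)
  upperAltSum≈-x∁ r x r≈Mx {S = S} i∉S = begin
    upperAltSum F r S
      ≈⟨ upperAltSum≈apply-möbius r S ⟩
    apply (tensor möbius) r S
      ≈⟨ apply-cong μ μ S (λ _ → refl) r≈intersecting-x ⟩
    apply (tensor möbius) (apply intersecting x) S
      ≈⟨ apply-möbius-intersecting x i∉S ⟩
    - x (∁ S) ∎
    where
    μ : Matrix _
    μ = tensor möbius
    r≈intersecting-x : ∀ T → r T ≈ apply intersecting x T
    r≈intersecting-x T =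
      trans (r≈Mx T) (apply-cong (intersectionMatrix F) intersecting T
                                 (intersectionMatrix≈intersecting T) (λ _ → refl))

  ≈-neg⇒≤0⇔0≤ : ∀ {a b} → a ≈ - b → (a ≤ 0# ⇔ 0# ≤ b)
  ≈-neg⇒≤0⇔0≤ {a} {b} a≈-b = mk⇔ a≤0⇒0≤b 0≤b⇒a≤0
    where
    a≤0⇒0≤b : a ≤ 0# → 0# ≤ b
    a≤0⇒0≤b a≤0 = ≤-respˡ-≈ (-‿inverseˡ b)
      (≤-respʳ-≈ (+-identityˡ b) (+-mono-≤ b (≤-respˡ-≈ a≈-b a≤0)))
    0≤b⇒a≤0 : 0# ≤ b → a ≤ 0#
    0≤b⇒a≤0 0≤b = ≤-respˡ-≈ (sym a≈-b)
      (≤-respˡ-≈ (+-identityˡ (- b)) (≤-respʳ-≈ (-‿inverseʳ b) (+-mono-≤ (- b) 0≤b)))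

mainTheorem2 : ∀ {c ℓ₁ ℓ₂} (F : OrderedField c ℓ₁ ℓ₂) (n : ℕ) → n ≥ 1 →
    (r x : Subset n → OrderedField.Carrier F) →
    OrderedField._≈_ F (r ⊥) (OrderedField.0# F) →
    (∀ S → Nonempty S → OrderedField._≈_ F (applyM F x S) (r S)) →
    ((∀ T → Nonempty T → OrderedField._≤_ F (OrderedField.0# F) (x T))
      ⇔ (∀ S → S ⊂ ⊤ → OrderedField._≤_ F (upperAltSum F r S) (OrderedField.0# F)))
mainTheorem2 F n _ r x r⊥≈0 Mx≈r = mk⇔ nonneg⇒altSums≤0 altSums≤0⇒nonneg
  where
  open OrderedField F

  r≈Mx : ∀ T → r T ≈ applyM F x T
  r≈Mx T with nonempty? T
  ... | yes T≢∅ = sym (Mx≈r T T≢∅)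
  ... | no  T≡∅ rewrite Empty-unique T≡∅ = trans r⊥≈0 (sym (applyM-⊥ F x))

  nonneg⇒altSums≤0 : (∀ T → Nonempty T → 0# ≤ x T) → ∀ S → S ⊂ ⊤ → upperAltSum F r S ≤ 0#
  nonneg⇒altSums≤0 x≥0 S (_ , i , _ , i∉S) =
    Equivalence.from (≈-neg⇒≤0⇔0≤ F (upperAltSum≈-x∁ F r x r≈Mx i∉S))
                     (x≥0 (∁ S) (i , x∉p⇒x∈∁p i∉S))

  altSums≤0⇒nonneg : (∀ S → S ⊂ ⊤ → upperAltSum F r S ≤ 0#) → ∀ T → Nonempty T → 0# ≤ x T
  altSums≤0⇒nonneg alt≤0 T (i , i∈T) =
    Equivalence.to (≈-neg⇒≤0⇔0≤ F altSum≈-xT) (alt≤0 (∁ T) ((λ _ → ∈⊤) , i , ∈⊤ , i∉∁T))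
    where
    i∉∁T : i ∉ ∁ T
    i∉∁T = x∈p⇒x∉∁p i∈T
    altSum≈-xT : upperAltSum F r (∁ T) ≈ - x T
    altSum≈-xT = trans (upperAltSum≈-x∁ F r x r≈Mx i∉∁T)
                       (reflexive (≡.cong (-_ ∘ x) (∁-involutive T)))
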